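{- Fix $n\in\mathbb{Z}_{\ge1}$, $k\in\mathbb{Z}_{\ge0}$ and $d\mid n$. The action of $C_d$ on $\mathcal{G}_{d,d}$ is trivial, and $(\mathcal{G}_{d,d},C_d,\mathcal{G}_{d,d}^{\mathrm{Sum}'}(q))$ exhibits the cyclic sieving phenomenon.
   Context: $[a,b]=\{i\in\mathbb{Z}:a\le i\le b\}$. $\mathcal{S}$ is the set of $k$-element subsets of $[0,n-1]$. For $j\in[1,n/d]$, $I_d^j=[(j-1)d,jd-1]$. $C_d$ is the cyclic group of order $d$ acting on $[0,n-1]$ (and elementwise on subsets) by the permutation simultaneously rotating each $I_d^j$: $x\mapsto x+1$ for $x\in I_d^j$, $x\ne jd-1$, and $jd-1\mapsto(j-1)d$. $\mathcal{G}_{d,d}=\{A\in\mathcal{S}:\gcd(d,\#(A\cap I_d^1),\dots,\#(A\cap I_d^{n/d}))=d\}$. $\mathrm{Sum}'(A)=\sum_{a\in A}a-\binom k2$ and $X^{\mathrm{Sum}'}(q)=\sum_{A\in X}q^{\mathrm{Sum}'(A)}$. For a finite set $W$ acted on by a cyclic group $C=\langle\tau\rangle$ of order $s$ and $f(q)\in\mathbb{N}[q]$, $(W,C,f(q))$ exhibits the CSP if $\#\{x\in W:\tau^jx=x\}=f(\omega_s^j)$ for all $j\in\mathbb{Z}$, $\omega_s$ a fixed primitive $s$-th root of unity. -}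

module Defs where

open import Level using (Level)
open import Data.Bool using (Bool; true; false; if_then_else_; _∧_; _∨_; T)
import Data.Bool as B
open import Data.Nat using (ℕ; zero; suc; _+_; _*_; _∸_; _≤_; _<_; _≡ᵇ_; _<ᵇ_; _≤ᵇ_)
import Data.Nat as N
open import Data.Nat.DivMod using (_%_; _/_)
open import Data.Nat.GCD using (gcd)
open import Data.Nat.Combinatorics using (_C_)
open import Data.Fin using (Fin; toℕ)
open import Data.Vec using (Vec; []; _∷_; tabulate; lookup; allFin; toList)
import Data.Vec.Properties as VP
open import Data.List using (List; []; _∷_; map; filter; length; foldr; upTo; _++_)
open import Data.Fin.Subset using (Subset; ∣_∣; inside; outside)
open import Data.Product using (_×_; _,_)
open import Relation.Nullary using (Dec; ¬_)
open import Relation.Nullary.Decidable using (_×-dec_)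
open import Relation.Binary.PropositionalEquality using (_≡_)
open import Algebra.Bundles using (CommutativeRing)

-- The set 𝒮 of k-element subsets of [0,n-1]; subsets of [0,n-1] are
-- represented by the library's 'Subset n' (element x ↔ Fin n with toℕ x).

allSubsets : (n : ℕ) → List (Subset n)
allSubsets zero    = [] ∷ []
allSubsets (suc n) = map (inside ∷_) (allSubsets n) ++ map (outside ∷_) (allSubsets n)

-- membership of a natural number x in A (false if x ≥ n)
memℕ : ∀ {n} → Subset n → ℕ → Bool
memℕ {n} A x = anyFin λ i → lookup A i ∧ (toℕ i ≡ᵇ x)
  where
  anyFin : (Fin n → Bool) → Bool
  anyFin p = foldr _∨_ false (toList (tabulate p))

-- The generator of C_d: rotates each block I_d^j = [(j-1)d, jd-1]
-- (x ↦ x+1 unless x = jd-1, and jd-1 ↦ (j-1)d).  For d = 0 (excluded by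
-- the hypotheses) it is the identity.

rot : ℕ → ℕ → ℕ
rot zero     x = x
rot (suc d') x = if suc (x % suc d') ≡ᵇ suc d' then x ∸ d' else suc x

act : ∀ {n} → ℕ → Subset n → Subset n
act {n} d A = tabulate λ y → foldr _∨_ false
  (toList (tabulate λ (x : Fin n) → lookup A x ∧ (rot d (toℕ x) ≡ᵇ toℕ y)))

actPow : ∀ {n} → ℕ → ℕ → Subset n → Subset n
actPow d zero    A = A
actPow d (suc j) A = act d (actPow d j A)

-- #(A ∩ I_d^j) for the block with (0-based) index b, i.e. j = b+1:
-- elements x with b*d ≤ x < (b+1)*d
blockCount : ∀ {n} → ℕ → Subset n → ℕ → ℕ
blockCount {n} d A b = length (filter (λ x → B.T? (memℕ A x ∧ ((b * d) ≤ᵇ x) ∧ (x <ᵇ (suc b * d)))) (upTo n))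

blockCounts : ∀ {n} → ℕ → Subset n → List ℕ
blockCounts     zero     A = []
blockCounts {n} (suc d') A = map (blockCount (suc d') A) (upTo (n / suc d'))

gcdWith : ℕ → List ℕ → ℕ
gcdWith d cs = foldr gcd d cs

inG : ∀ {n} → ℕ → ℕ → Subset n → Set
inG k d A = (∣ A ∣ ≡ k) × (gcdWith d (blockCounts d A) ≡ d)

inG? : ∀ {n} k d (A : Subset n) → Dec (inG k d A)
inG? k d A = (∣ A ∣ N.≟ k) ×-dec (gcdWith d (blockCounts d A) N.≟ d)

G : (n k d : ℕ) → List (Subset n)
G n k d = filter (inG? k d) (allSubsets n)

numFixed : ∀ {n} → ℕ → ℕ → List (Subset n) → ℕ
numFixed d j W = length (filter (λ A → VP.≡-dec B._≟_ (actPow d j A) A) W)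

sumElems : ∀ {n} → Subset n → ℕ
sumElems {n} A = foldr _+_ 0 (toList (tabulate λ (x : Fin n) → if lookup A x then toℕ x else 0))

Sum′ : ∀ {n} → Subset n → ℕ
Sum′ A = sumElems A ∸ (∣ A ∣ C 2)

module _ {c ℓ : Level} (R : CommutativeRing c ℓ) where
  open CommutativeRing R using (Carrier; _≈_; 1#; 0#) renaming (_+_ to _+R_; _*_ to _*R_)

  pow : Carrier → ℕ → Carrier
  pow x zero    = 1#
  pow x (suc m) = x *R pow x m

  fromℕ : ℕ → Carrier
  fromℕ zero    = 0#
  fromℕ (suc m) = 1# +R fromℕ m

  IsPrimitiveRoot : ℕ → Carrier → Set ℓ
  IsPrimitiveRoot s ω = (pow ω s ≈ 1#) × (∀ i → 0 < i → i < s → ¬ (pow ω i ≈ 1#))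

  genFunSum′ : ∀ {n} → List (Subset n) → Carrier → Carrier
  genFunSum′ X q = foldr (λ A acc → pow q (Sum′ A) +R acc) 0# X

module Submission where

-- Write D = d > 0 (d = 0 cannot divide n ≥ 1) and n = M·D, so [0,n) is the union
-- of the M blocks [b·D, b·D + D).  For A ∈ 𝒢_{d,d} the gcd condition says D divides
-- every block count #(A ∩ I_D^{b+1}) ≤ D, so each block is either empty or full:
-- the indicator of A is "block-constant".  Two consequences are proved:
--   * rot D maps every block onto itself, so it preserves a block-constant set and
--     permutes [0,n); hence the image of A under rot D is A (the action is trivial);
--   * filling the blocks one at a time keeps Σ_{a∈A} a ≡ binom(#A,2) (mod D),
--     so D ∣ Sum′(A).
-- Finally, if τ fixes every element of W and D ∣ Sum′(A) for all A ∈ W, then for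
-- every j both sides of the CSP equation equal #W: each τ^j fixes all of W, and
-- every term (ω^j)^{Sum′(A)} equals 1 since ω^D = 1.

open import Defs
open import Level using (Level)
open import Function using (_∘_)
open import Data.Empty using (⊥-elim)
open import Data.Unit using (tt)
open import Data.Bool using (Bool; true; false; if_then_else_; _∧_; _∨_; T)
import Data.Bool as Bool
open import Data.Bool.Properties using (∧-zeroʳ; ∧-identityʳ; ∨-zeroʳ)
open import Data.Nat using (ℕ; zero; suc; _+_; _*_; _∸_; _≤_; _<_; z≤n; s≤s; z<s; _≡ᵇ_; _≤ᵇ_; _<ᵇ_)
open import Data.Nat.Properties
open import Data.Nat.DivMod using (_%_; _/_; m%n<n; m≡m%n+[m/n]*n; m/n*n≤m; [m+kn]%n≡m%n; m<n⇒m%n≡m; m*n/n≡m)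
open import Data.Nat.Divisibility using (_∣_; divides; ∣-trans; ∣⇒≤; 0∣⇒≡0)
open import Data.Nat.GCD using (gcd[m,n]∣m; gcd[m,n]∣n)
open import Data.Nat.Combinatorics using (_C_; nC1≡n; nCk+nC[k+1]≡[n+1]C[k+1])
open import Data.Nat.Tactic.RingSolver using (solve-∀)
open import Algebra.Properties.CommutativeSemigroup +-commutativeSemigroup using (interchange)
open import Data.Fin using (Fin; toℕ; fromℕ<) renaming (zero to fzero; suc to fsuc)
open import Data.Fin.Properties using (toℕ-fromℕ<; toℕ<n)
open import Data.Fin.Subset using (Subset; ∣_∣)
open import Data.Vec using ([]; _∷_; tabulate; lookup; toList)
open import Data.Vec.Properties using (tabulate-cong; tabulate∘lookup; ≡-dec)
open import Data.List using (List; []; _∷_; length; filter; foldr; applyUpTo)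
open import Data.List.Properties using (filter-all)
import Data.List.Relation.Unary.All as All
open import Data.List.Relation.Unary.All using (All; []; _∷_)
open import Data.List.Relation.Unary.All.Properties using (all-filter; map⁻; applyUpTo⁻)
open import Data.List.Membership.Propositional using (_∈_)
open import Data.Product using (∃; ∃-syntax; _×_; _,_; proj₁; proj₂)
open import Data.Sum using (_⊎_; inj₁; inj₂)
open import Relation.Nullary using (¬_)
open import Relation.Binary.PropositionalEquality using (_≡_; _≢_; refl; sym; trans; cong; cong₂; subst; module ≡-Reasoning)
open import Algebra.Bundles using (CommutativeRing)
import Algebra.Properties.Semiring.Exp as Exp

T⇒≡true : ∀ {b} → T b → b ≡ true
T⇒≡true {true} _ = refl

¬T⇒≡false : ∀ {b} → ¬ T b → b ≡ false
¬T⇒≡false {true}  ¬Tb = ⊥-elim (¬Tb tt)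
¬T⇒≡false {false} _   = refl

≡ᵇ-refl : ∀ m → (m ≡ᵇ m) ≡ true
≡ᵇ-refl m = T⇒≡true (≡⇒≡ᵇ m m refl)

≢⇒≡ᵇfalse : ∀ {m n} → m ≢ n → (m ≡ᵇ n) ≡ false
≢⇒≡ᵇfalse {m} {n} m≢n = ¬T⇒≡false (m≢n ∘ ≡ᵇ⇒≡ m n)

-- sumTo N h = h 0 + h 1 + ⋯ + h (N ∸ 1), defined by peeling off the first term
-- so that it unfolds along with vectors and 'applyUpTo'.
sumTo : ℕ → (ℕ → ℕ) → ℕ
sumTo zero    h = 0
sumTo (suc N) h = h 0 + sumTo N (h ∘ suc)

sumTo-cong : ∀ N {g h : ℕ → ℕ} → (∀ x → x < N → g x ≡ h x) → sumTo N g ≡ sumTo N h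
sumTo-cong zero    g≡h = refl
sumTo-cong (suc N) g≡h = cong₂ _+_ (g≡h 0 z<s) (sumTo-cong N (λ x x<N → g≡h (suc x) (s≤s x<N)))

sumTo-const : ∀ N c → sumTo N (λ _ → c) ≡ N * c
sumTo-const zero    c = refl
sumTo-const (suc N) c = cong (c +_) (sumTo-const N c)

sumTo-zero : ∀ N {h : ℕ → ℕ} → (∀ x → x < N → h x ≡ 0) → sumTo N h ≡ 0
sumTo-zero N h≡0 = trans (sumTo-cong N h≡0) (trans (sumTo-const N 0) (*-zeroʳ N))

sumTo-split : ∀ a c (h : ℕ → ℕ) → sumTo (a + c) h ≡ sumTo a h + sumTo c (λ r → h (a + r))
sumTo-split zero    c h = refl
sumTo-split (suc a) c h = trans (cong (h 0 +_) (sumTo-split a c (h ∘ suc))) (sym (+-assoc (h 0) _ _))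

sumTo-+ : ∀ N (g h : ℕ → ℕ) → sumTo N (λ x → g x + h x) ≡ sumTo N g + sumTo N h
sumTo-+ zero    g h = refl
sumTo-+ (suc N) g h =
  trans (cong (g 0 + h 0 +_) (sumTo-+ N (g ∘ suc) (h ∘ suc))) (interchange (g 0) (h 0) _ _)

tri : ℕ → ℕ
tri N = sumTo N (λ x → x)

sumTo-shift : ∀ c a → sumTo c (λ r → a + r) ≡ c * a + tri c
sumTo-shift c a = trans (sumTo-+ c (λ _ → a) (λ r → r)) (cong (_+ tri c) (sumTo-const c a))

tri-+ : ∀ a c → tri (a + c) ≡ tri a + (c * a + tri c)
tri-+ a c = trans (sumTo-split a c (λ x → x)) (cong (tri a +_) (sumTo-shift c a))

C2≡tri : ∀ x → x C 2 ≡ tri x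
C2≡tri zero    = refl
C2≡tri (suc x) = begin
  suc x C 2      ≡⟨ nCk+nC[k+1]≡[n+1]C[k+1] x 1 ⟨
  x C 1 + x C 2  ≡⟨ cong₂ _+_ (trans (nC1≡n x) (sym (*-identityʳ x))) (C2≡tri x) ⟩
  x * 1 + tri x  ≡⟨ sumTo-shift x 1 ⟨
  tri (suc x)    ∎
  where open ≡-Reasoning

ind : Bool → ℕ
ind true  = 1
ind false = 0

count : ℕ → (ℕ → Bool) → ℕ
count N g = sumTo N (ind ∘ g)

count-cong : ∀ N {g h : ℕ → Bool} → (∀ x → x < N → g x ≡ h x) → count N g ≡ count N h
count-cong N g≡h = sumTo-cong N (λ x x<N → cong ind (g≡h x x<N))

count-zero : ∀ N {g : ℕ → Bool} → (∀ x → x < N → g x ≡ false) → count N g ≡ 0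
count-zero N off = sumTo-zero N (λ x x<N → cong ind (off x x<N))

count≤ : ∀ N g → count N g ≤ N
count≤ zero    g = z≤n
count≤ (suc N) g with g 0
... | true  = s≤s (count≤ N (g ∘ suc))
... | false = m≤n⇒m≤1+n (count≤ N (g ∘ suc))

count≡0 : ∀ N g → count N g ≡ 0 → ∀ r → r < N → g r ≡ false
count≡0 (suc N) g c≡0 zero    _   = ind≡0 (m+n≡0⇒m≡0 (ind (g 0)) c≡0)
  where
  ind≡0 : ∀ {b} → ind b ≡ 0 → b ≡ false
  ind≡0 {false} _ = refl
count≡0 (suc N) g c≡0 (suc r) r<N = count≡0 N (g ∘ suc) (m+n≡0⇒n≡0 (ind (g 0)) c≡0) r (≤-pred r<N)

count-full-head : ∀ N g → count (suc N) g ≡ suc N → (g 0 ≡ true) × (count N (g ∘ suc) ≡ N)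
count-full-head N g c≡ with g 0
... | true  = refl , suc-injective c≡
... | false = ⊥-elim (1+n≰n (subst (_≤ N) c≡ (count≤ N (g ∘ suc))))

count≡N : ∀ N g → count N g ≡ N → ∀ r → r < N → g r ≡ true
count≡N (suc N) g c≡N zero    _   = proj₁ (count-full-head N g c≡N)
count≡N (suc N) g c≡N (suc r) r<N = count≡N N (g ∘ suc) (proj₂ (count-full-head N g c≡N)) r (≤-pred r<N)

count-filter : ∀ N (F : ℕ → ℕ) (g : ℕ → Bool) →
  length (filter (λ x → Bool.T? (g x)) (applyUpTo F N)) ≡ count N (g ∘ F)
count-filter zero    F g = refl
count-filter (suc N) F g with g (F 0)
... | true  = cong suc (count-filter N (F ∘ suc) g)
... | false = count-filter N (F ∘ suc) g

inWindow : ℕ → ℕ → ℕ → Bool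
inWindow a c x = (a ≤ᵇ x) ∧ (x <ᵇ c + a)

inWindow-below : ∀ a c x → x < a → inWindow a c x ≡ false
inWindow-below a c x x<a = cong (_∧ (x <ᵇ c + a)) (¬T⇒≡false (<⇒≱ x<a ∘ ≤ᵇ⇒≤ a x))

inWindow-inside : ∀ a c r → r < c → inWindow a c (a + r) ≡ true
inWindow-inside a c r r<c = cong₂ _∧_ (T⇒≡true (≤⇒≤ᵇ (m≤m+n a r)))
  (T⇒≡true (<⇒<ᵇ (subst (a + r <_) (+-comm a c) (+-monoʳ-< a r<c))))

inWindow-above : ∀ a c r → inWindow a c (a + (c + r)) ≡ false
inWindow-above a c r = trans (cong ((a ≤ᵇ a + (c + r)) ∧_) beyond) (∧-zeroʳ _)
  where
  c+a≤ : c + a ≤ a + (c + r)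
  c+a≤ = subst (_≤ a + (c + r)) (+-comm a c) (+-monoʳ-≤ a (m≤m+n c r))
  beyond : (a + (c + r) <ᵇ c + a) ≡ false
  beyond = ¬T⇒≡false (λ t → <⇒≱ (<ᵇ⇒< _ _ t) c+a≤)

count-window : ∀ a c e (g : ℕ → Bool) →
  count (a + (c + e)) (λ x → g x ∧ inWindow a c x) ≡ count c (λ r → g (a + r))
count-window a c e g = begin
  count (a + (c + e)) W
    ≡⟨ sumTo-split a (c + e) (ind ∘ W) ⟩
  count a W + count (c + e) (λ r → W (a + r))
    ≡⟨ cong (count a W +_) (sumTo-split c e (λ r → ind (W (a + r)))) ⟩
  count a W + (count c (λ r → W (a + r)) + count e (λ r → W (a + (c + r))))
    ≡⟨ cong₂ _+_ before (cong₂ _+_ inside after) ⟩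
  0 + (count c (λ r → g (a + r)) + 0)
    ≡⟨ +-identityʳ _ ⟩
  count c (λ r → g (a + r)) ∎
  where
  open ≡-Reasoning
  W : ℕ → Bool
  W x = g x ∧ inWindow a c x
  before : count a W ≡ 0
  before = count-zero a (λ x x<a → trans (cong (g x ∧_) (inWindow-below a c x x<a)) (∧-zeroʳ (g x)))
  inside : count c (λ r → W (a + r)) ≡ count c (λ r → g (a + r))
  inside = count-cong c (λ r r<c → trans (cong (g (a + r) ∧_) (inWindow-inside a c r r<c)) (∧-identityʳ _))
  after : count e (λ r → W (a + (c + r))) ≡ 0
  after = count-zero e (λ r _ → trans (cong (g (a + (c + r)) ∧_) (inWindow-above a c r)) (∧-zeroʳ _))

memberSum : (ℕ → Bool) → ℕ → ℕ
memberSum f N = sumTo N (λ x → if f x then x else 0)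

stretch-false : ∀ X c f → (∀ r → r < c → f (X + r) ≡ false) →
  (count (X + c) f ≡ count X f) × (memberSum f (X + c) ≡ memberSum f X)
stretch-false X c f off =
  trans (sumTo-split X c _) (trans (cong (count X f +_) (count-zero c off)) (+-identityʳ _)) ,
  trans (sumTo-split X c _) (trans (cong (memberSum f X +_) (sumTo-zero c vanish)) (+-identityʳ _))
  where
  vanish : ∀ r → r < c → (if f (X + r) then X + r else 0) ≡ 0
  vanish r r<c = cong (λ b → if b then X + r else 0) (off r r<c)

stretch-true : ∀ X c f → (∀ r → r < c → f (X + r) ≡ true) →
  (count (X + c) f ≡ count X f + c) × (memberSum f (X + c) ≡ memberSum f X + (c * X + tri c))
stretch-true X c f on =
  trans (sumTo-split X c _) (cong (count X f +_) (trans (count-cong c on) (trans (sumTo-const c 1) (*-identityʳ c)))) ,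
  trans (sumTo-split X c _) (cong (memberSum f X +_) (trans (sumTo-cong c keep) (sumTo-shift c X)))
  where
  keep : ∀ r → r < c → (if f (X + r) then X + r else 0) ≡ X + r
  keep r r<c = cong (λ b → if b then X + r else 0) (on r r<c)

gcdWith-∣ : ∀ d cs → All (gcdWith d cs ∣_) cs
gcdWith-∣ d []       = []
gcdWith-∣ d (c ∷ cs) = gcd[m,n]∣m c _ ∷ All.map (∣-trans (gcd[m,n]∣n c _)) (gcdWith-∣ d cs)

multiple≤ : ∀ {D c} → D ∣ c → c ≤ D → c ≡ 0 ⊎ c ≡ D
multiple≤ {c = zero}  _   _   = inj₁ refl
multiple≤ {c = suc _} D∣c c≤D = inj₂ (≤-antisym c≤D (∣⇒≤ D∣c))

χ : ∀ {n} → Subset n → ℕ → Bool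
χ []      x       = false
χ (a ∷ A) zero    = a
χ (a ∷ A) (suc x) = χ A x

lookup≡χ : ∀ {n} (A : Subset n) i → lookup A i ≡ χ A (toℕ i)
lookup≡χ (a ∷ A) fzero    = refl
lookup≡χ (a ∷ A) (fsuc i) = lookup≡χ A i

χ⇒< : ∀ {n} (A : Subset n) x → χ A x ≡ true → x < n
χ⇒< []      x       ()
χ⇒< (a ∷ A) zero    _   = z<s
χ⇒< (a ∷ A) (suc x) χx  = s≤s (χ⇒< A x χx)

card≡count : ∀ {n} (A : Subset n) → ∣ A ∣ ≡ count n (χ A)
card≡count []          = refl
card≡count (true  ∷ A) = cong suc (card≡count A)
card≡count (false ∷ A) = card≡count A

sum-tabulate : ∀ n (h : ℕ → ℕ) → foldr _+_ 0 (toList (tabulate {n = n} (h ∘ toℕ))) ≡ sumTo n h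
sum-tabulate zero    h = refl
sum-tabulate (suc n) h = cong (h 0 +_) (sum-tabulate n (h ∘ suc))

sumElems≡memberSum : ∀ {n} (A : Subset n) → sumElems A ≡ memberSum (χ A) n
sumElems≡memberSum {n} A = trans (cong (foldr _+_ 0 ∘ toList) (tabulate-cong byχ)) (sum-tabulate n _)
  where
  byχ : ∀ i → (if lookup A i then toℕ i else 0) ≡ (if χ A (toℕ i) then toℕ i else 0)
  byχ i = cong (λ b → if b then toℕ i else 0) (lookup≡χ A i)

anyFin : ∀ {n} → (Fin n → Bool) → Bool
anyFin p = foldr _∨_ false (toList (tabulate p))

anyFin-true : ∀ {n} (p : Fin n → Bool) i → p i ≡ true → anyFin p ≡ true
anyFin-true p fzero    pi≡ rewrite pi≡ = refl
anyFin-true p (fsuc i) pi≡ rewrite anyFin-true (p ∘ fsuc) i pi≡ = ∨-zeroʳ (p fzero)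

anyFin-false : ∀ {n} (p : Fin n → Bool) → (∀ i → p i ≡ false) → anyFin p ≡ false
anyFin-false {zero}  p _   = refl
anyFin-false {suc n} p p≡ rewrite p≡ fzero = anyFin-false (p ∘ fsuc) (p≡ ∘ fsuc)

hits : ∀ {n} → Subset n → (ℕ → ℕ) → ℕ → Bool
hits A ρ y = anyFin (λ i → lookup A i ∧ (ρ (toℕ i) ≡ᵇ y))

hits-true : ∀ {n} (A : Subset n) ρ {x y} → χ A x ≡ true → ρ x ≡ y → hits A ρ y ≡ true
hits-true A ρ {x} {y} χx ρx≡y = anyFin-true _ (fromℕ< x<n) hit
  where
  x<n = χ⇒< A x χx
  hit : (lookup A (fromℕ< x<n) ∧ (ρ (toℕ (fromℕ< x<n)) ≡ᵇ y)) ≡ true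
  hit rewrite lookup≡χ A (fromℕ< x<n) | toℕ-fromℕ< x<n | χx | ρx≡y = ≡ᵇ-refl y

hits-false : ∀ {n} (A : Subset n) ρ {y} → (∀ x → χ A x ≡ true → ρ x ≢ y) → hits A ρ y ≡ false
hits-false A ρ {y} miss = anyFin-false _ noHit
  where
  noHit : ∀ i → (lookup A i ∧ (ρ (toℕ i) ≡ᵇ y)) ≡ false
  noHit i with lookup A i in Ai
  ... | false = refl
  ... | true  = ≢⇒≡ᵇfalse (miss (toℕ i) (trans (sym (lookup≡χ A i)) Ai))

-- memℕ (used by blockCount) agrees with χ: it is the image of A under the identity
memℕ≡χ : ∀ {n} (A : Subset n) x → memℕ A x ≡ χ A x
memℕ≡χ A x with χ A x in χx
... | true  = hits-true A (λ z → z) χx refl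
... | false = hits-false A (λ z → z) (λ { x′ χx′ refl → ⊥-elim (false≢true (trans (sym χx) χx′)) })
  where
  false≢true : false ≢ true
  false≢true ()

-- the image of A under ρ; act d A is by definition the image under rot d
image : ∀ {n} → (ℕ → ℕ) → Subset n → Subset n
image ρ A = tabulate (hits A ρ ∘ toℕ)

image-invariant : ∀ {n} (A : Subset n) (ρ : ℕ → ℕ) →
  (∀ x → x < n → χ A (ρ x) ≡ χ A x) → (∀ y → y < n → ∃[ x ] x < n × ρ x ≡ y) →
  image ρ A ≡ A
image-invariant {n} A ρ preserves onto = trans (tabulate-cong pointwise) (tabulate∘lookup A)
  where
  pointwise : ∀ y → hits A ρ (toℕ y) ≡ lookup A y
  pointwise y rewrite lookup≡χ A y with χ A (toℕ y) in χy
  ... | true  with onto (toℕ y) (toℕ<n y)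
  ...   | x , x<n , ρx≡y = hits-true A ρ (trans (sym (preserves x x<n)) (trans (cong (χ A) ρx≡y) χy)) ρx≡y
  pointwise y | false = hits-false A ρ clash
    where
    clash : ∀ x → χ A x ≡ true → ρ x ≢ toℕ y
    clash x χx ρx≡y with () ← trans (sym χy) (trans (cong (χ A) (sym ρx≡y)) (trans (preserves x (χ⇒< A x χx)) χx))

module Blocks (d′ : ℕ) where

  D : ℕ
  D = suc d′

  offset-mod : ∀ b r → r < D → (b * D + r) % D ≡ r
  offset-mod b r r<D = trans (cong (_% D) (+-comm (b * D) r)) (trans ([m+kn]%n≡m%n r b D) (m<n⇒m%n≡m r<D))

  rot-at : ∀ x r → x % D ≡ r → rot D x ≡ (if r ≡ᵇ d′ then x ∸ d′ else suc x)
  rot-at x r x%D≡r = cong (λ t → if suc t ≡ᵇ D then x ∸ d′ else suc x) x%D≡r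

  rot-inner : ∀ b r → r < d′ → rot D (b * D + r) ≡ b * D + suc r
  rot-inner b r r<d′ = begin
    rot D (b * D + r)
      ≡⟨ rot-at _ r (offset-mod b r (m<n⇒m<1+n r<d′)) ⟩
    (if r ≡ᵇ d′ then b * D + r ∸ d′ else suc (b * D + r))
      ≡⟨ cong (λ t → if t then b * D + r ∸ d′ else suc (b * D + r)) (≢⇒≡ᵇfalse (<⇒≢ r<d′)) ⟩
    suc (b * D + r)
      ≡⟨ +-suc (b * D) r ⟨
    b * D + suc r ∎
    where open ≡-Reasoning

  rot-last : ∀ b → rot D (b * D + d′) ≡ b * D
  rot-last b = begin
    rot D (b * D + d′)
      ≡⟨ rot-at _ d′ (offset-mod b d′ ≤-refl) ⟩
    (if d′ ≡ᵇ d′ then b * D + d′ ∸ d′ else suc (b * D + d′))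
      ≡⟨ cong (λ t → if t then b * D + d′ ∸ d′ else suc (b * D + d′)) (≡ᵇ-refl d′) ⟩
    b * D + d′ ∸ d′
      ≡⟨ m+n∸n≡m (b * D) d′ ⟩
    b * D ∎
    where open ≡-Reasoning

  rot-within : ∀ b r → r < D → ∃[ r′ ] r′ < D × rot D (b * D + r) ≡ b * D + r′
  rot-within b r r<D with m<1+n⇒m<n∨m≡n r<D
  ... | inj₁ r<d′ = suc r , s≤s r<d′ , rot-inner b r r<d′
  ... | inj₂ refl = 0 , z<s , trans (rot-last b) (sym (+-identityʳ (b * D)))

  rot-onto : ∀ b r → r < D → ∃[ r₀ ] r₀ < D × rot D (b * D + r₀) ≡ b * D + r
  rot-onto b zero    _      = d′ , ≤-refl , trans (rot-last b) (sym (+-identityʳ (b * D)))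
  rot-onto b (suc r) 1+r<D  = r , m<n⇒m<1+n r<d′ , rot-inner b r r<d′
    where r<d′ = ≤-pred 1+r<D

  decompose : ∀ M x → x < M * D → ∃[ b ] ∃[ r ] b < M × r < D × x ≡ b * D + r
  decompose M x x<MD = x / D , x % D , x/D<M , m%n<n x D , trans (m≡m%n+[m/n]*n x D) (+-comm (x % D) _)
    where x/D<M = *-cancelʳ-< D (x / D) M (≤-<-trans (m/n*n≤m x D) x<MD)

  inRange : ∀ M b r → b < M → r < D → b * D + r < M * D
  inRange M b r b<M r<D = <-≤-trans (+-monoʳ-< (b * D) r<D)
    (subst (_≤ M * D) (+-comm D (b * D)) (*-monoˡ-≤ D b<M))

  ConstantOn : (ℕ → Bool) → ℕ → Bool → Set
  ConstantOn f b v = ∀ r → r < D → f (b * D + r) ≡ v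

  BlockConstant : (ℕ → Bool) → ℕ → Set
  BlockConstant f M = ∀ b → b < M → ∃ (ConstantOn f b)

  rot-preserves : ∀ M f → BlockConstant f M → ∀ x → x < M * D → f (rot D x) ≡ f x
  rot-preserves M f blocks x x<MD with decompose M x x<MD
  ... | b , r , b<M , r<D , refl with blocks b b<M | rot-within b r r<D
  ...   | v , const | r′ , r′<D , rot≡ = trans (cong f rot≡) (trans (const r′ r′<D) (sym (const r r<D)))

  rot-surjective : ∀ M y → y < M * D → ∃[ x ] x < M * D × rot D x ≡ y
  rot-surjective M y y<MD with decompose M y y<MD
  ... | b , r , b<M , r<D , refl with rot-onto b r r<D
  ...   | r₀ , r₀<D , rot≡ = b * D + r₀ , inRange M b r₀ b<M r₀<D , rot≡

  act-trivial : ∀ {n} M → n ≡ M * D → (A : Subset n) → BlockConstant (χ A) M → act D A ≡ A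
  act-trivial M refl A blocks = image-invariant A (rot D) (rot-preserves M (χ A) blocks) (rot-surjective M)

  blockCount≡ : ∀ {n} M → n ≡ M * D → (A : Subset n) → ∀ b → b < M →
    blockCount D A b ≡ count D (λ r → χ A (b * D + r))
  blockCount≡ {n} M n≡MD A b b<M = begin
    blockCount D A b
      ≡⟨ count-filter n (λ x → x) (λ x → memℕ A x ∧ inWindow (b * D) D x) ⟩
    count n (λ x → memℕ A x ∧ inWindow (b * D) D x)
      ≡⟨ count-cong n (λ x _ → cong (_∧ inWindow (b * D) D x) (memℕ≡χ A x)) ⟩
    count n (λ x → χ A x ∧ inWindow (b * D) D x)
      ≡⟨ cong (λ N → count N (λ x → χ A x ∧ inWindow (b * D) D x)) n≡ ⟩
    count (b * D + (D + (M ∸ suc b) * D)) (λ x → χ A x ∧ inWindow (b * D) D x)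
      ≡⟨ count-window (b * D) D ((M ∸ suc b) * D) (χ A) ⟩
    count D (λ r → χ A (b * D + r)) ∎
    where
    open ≡-Reasoning
    distribute : ∀ b e c → (suc b + e) * c ≡ b * c + (c + e * c)
    distribute = solve-∀
    n≡ : n ≡ b * D + (D + (M ∸ suc b) * D)
    n≡ = trans n≡MD (trans (cong (_* D) (sym (m+[n∸m]≡n b<M))) (distribute b (M ∸ suc b) D))

  gcd⇒blockConstant : ∀ {n} M → n ≡ M * D → (A : Subset n) →
    gcdWith D (blockCounts D A) ≡ D → BlockConstant (χ A) M
  gcd⇒blockConstant {n} M n≡MD A gcd≡D b b<M with multiple≤ D∣count (count≤ D inBlock)
    where
    inBlock : ℕ → Bool
    inBlock r = χ A (b * D + r)
    D∣counts : All (λ b → D ∣ blockCount D A b) (applyUpTo (λ x → x) (n / D))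
    D∣counts = map⁻ (subst (λ g → All (g ∣_) (blockCounts D A)) gcd≡D (gcdWith-∣ D (blockCounts D A)))
    n/D≡M : n / D ≡ M
    n/D≡M = trans (cong (_/ D) n≡MD) (m*n/n≡m M D)
    D∣count : D ∣ count D inBlock
    D∣count = subst (D ∣_) (blockCount≡ M n≡MD A b b<M)
      (applyUpTo⁻ _ M (subst (λ m → All (λ b → D ∣ blockCount D A b) (applyUpTo (λ x → x) m)) n/D≡M D∣counts) b<M)
  ... | inj₁ empty = false , count≡0 D _ empty
  ... | inj₂ full  = true  , count≡N D _ full

  appendBlock : ∀ X f v → (∀ r → r < D → f (X + r) ≡ v) →
    ∀ t → memberSum f X ≡ tri (count X f) + D * t →
    ∃[ t′ ] memberSum f (X + D) ≡ tri (count (X + D) f) + D * t′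
  appendBlock X f false off t sum≡ with stretch-false X D f off
  ... | count≡ , step≡ = t , trans step≡ (trans sum≡ (cong (λ K → tri K + D * t) (sym count≡)))
  appendBlock X f true on t sum≡ with stretch-true X D f on
  ... | count≡ , step≡ = t + e , (begin
    memberSum f (X + D)
      ≡⟨ step≡ ⟩
    memberSum f X + (D * X + tri D)
      ≡⟨ cong₂ _+_ sum≡ (cong (λ z → D * z + tri D) (sym (m+[n∸m]≡n (count≤ X f)))) ⟩
    tri K + D * t + (D * (K + e) + tri D)
      ≡⟨ rearrange (tri K) D t K e (tri D) ⟩
    tri K + (D * K + tri D) + D * (t + e)
      ≡⟨ cong (_+ D * (t + e)) (tri-+ K D) ⟨
    tri (K + D) + D * (t + e)
      ≡⟨ cong (λ z → tri z + D * (t + e)) count≡ ⟨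
    tri (count (X + D) f) + D * (t + e) ∎)
    where
    open ≡-Reasoning
    K = count X f
    e = X ∸ K
    rearrange : ∀ a c t k m s → a + c * t + (c * (k + m) + s) ≡ a + (c * k + s) + c * (t + m)
    rearrange = solve-∀

  blockConstant-sum : ∀ M f → BlockConstant f M →
    ∃[ t ] memberSum f (M * D) ≡ tri (count (M * D) f) + D * t
  blockConstant-sum zero    f _      = 0 , sym (*-zeroʳ D)
  blockConstant-sum (suc M) f blocks with blockConstant-sum M f (λ b b<M → blocks b (m<n⇒m<1+n b<M))
  ... | t , sum≡ with blocks M (n<1+n M)
  ...   | v , const = subst (λ N → ∃[ t′ ] memberSum f N ≡ tri (count N f) + D * t′)
                        (+-comm (M * D) D) (appendBlock (M * D) f v const t sum≡)

  Sum′-divisible : ∀ {n} M → n ≡ M * D → (A : Subset n) → BlockConstant (χ A) M → D ∣ Sum′ A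
  Sum′-divisible M refl A blocks with blockConstant-sum M (χ A) blocks
  ... | t , sum≡ = divides t (begin
    Sum′ A
      ≡⟨ cong₂ _∸_ (sumElems≡memberSum A) (trans (cong (_C 2) (card≡count A)) (C2≡tri K)) ⟩
    memberSum (χ A) (M * D) ∸ tri K
      ≡⟨ cong (_∸ tri K) sum≡ ⟩
    tri K + D * t ∸ tri K
      ≡⟨ m+n∸m≡n (tri K) (D * t) ⟩
    D * t
      ≡⟨ *-comm D t ⟩
    t * D ∎)
    where
    open ≡-Reasoning
    K = count (M * D) (χ A)

actPow-fixed : ∀ {n} d (A : Subset n) → act d A ≡ A → ∀ j → actPow d j A ≡ A
actPow-fixed d A τA≡A zero    = refl
actPow-fixed d A τA≡A (suc j) = trans (cong (act d) (actPow-fixed d A τA≡A j)) τA≡A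

numFixed-all : ∀ {n} d j (W : List (Subset n)) → All (λ A → act d A ≡ A) W → numFixed d j W ≡ length W
numFixed-all d j W fixed =
  cong length (filter-all (λ A → ≡-dec Bool._≟_ (actPow d j A) A) (All.map (λ {A} τA≡A → actPow-fixed d A τA≡A j) fixed))

module _ {c ℓ : Level} (R : CommutativeRing c ℓ) where
  open CommutativeRing R using (_≈_; 1#; semiring; setoid)
    renaming (refl to ≈-refl; sym to ≈-sym; trans to ≈-trans; +-cong to +ᴿ-cong; *-identityˡ to *ᴿ-identityˡ)
  open Exp semiring using (_^_; ^-assocʳ; ^-congˡ)
  open import Relation.Binary.Reasoning.Setoid setoid

  pow≡^ : ∀ x m → pow R x m ≡ x ^ m
  pow≡^ x zero    = refl
  pow≡^ x (suc m) = cong (CommutativeRing._*_ R x) (pow≡^ x m)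

  1#^ : ∀ m → 1# ^ m ≈ 1#
  1#^ zero    = ≈-refl
  1#^ (suc m) = ≈-trans (*ᴿ-identityˡ _) (1#^ m)

  root^multiple : ∀ q d t → pow R q d ≈ 1# → pow R q (d * t) ≈ 1#
  root^multiple q d t qᵈ≈1 = begin
    pow R q (d * t) ≡⟨ pow≡^ q (d * t) ⟩
    q ^ (d * t)     ≈⟨ ^-assocʳ q d t ⟨
    (q ^ d) ^ t     ≈⟨ ^-congˡ t (subst (_≈ 1#) (pow≡^ q d) qᵈ≈1) ⟩
    1# ^ t          ≈⟨ 1#^ t ⟩
    1#              ∎

  pow-root : ∀ ω d j → pow R ω d ≈ 1# → pow R (pow R ω j) d ≈ 1#
  pow-root ω d j ωᵈ≈1 = begin
    pow R (pow R ω j) d ≡⟨ trans (pow≡^ _ d) (cong (_^ d) (pow≡^ ω j)) ⟩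
    (ω ^ j) ^ d         ≈⟨ ^-assocʳ ω j d ⟩
    ω ^ (j * d)         ≡⟨ trans (cong (ω ^_) (*-comm j d)) (sym (pow≡^ ω (d * j))) ⟩
    pow R ω (d * j)     ≈⟨ root^multiple ω d j ωᵈ≈1 ⟩
    1#                  ∎

  genFun-at-root : ∀ {n} d (W : List (Subset n)) q → pow R q d ≈ 1# →
    All (λ A → d ∣ Sum′ A) W → fromℕ R (length W) ≈ genFunSum′ R W q
  genFun-at-root d []      q qᵈ≈1 []                         = ≈-refl
  genFun-at-root d (A ∷ W) q qᵈ≈1 (divides t Sum′≡ ∷ divisible) =
    +ᴿ-cong (≈-sym term≈1) (genFun-at-root d W q qᵈ≈1 divisible)
    where
    term≈1 : pow R q (Sum′ A) ≈ 1#
    term≈1 = subst (λ e → pow R q e ≈ 1#) (trans (*-comm d t) (sym Sum′≡)) (root^multiple q d t qᵈ≈1)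

  trivial-csp : ∀ {n} d (W : List (Subset n)) ω → pow R ω d ≈ 1# →
    All (λ A → act d A ≡ A) W → All (λ A → d ∣ Sum′ A) W →
    ∀ j → fromℕ R (numFixed d j W) ≈ genFunSum′ R W (pow R ω j)
  trivial-csp d W ω ωᵈ≈1 fixed divisible j = begin
    fromℕ R (numFixed d j W)        ≡⟨ cong (fromℕ R) (numFixed-all d j W fixed) ⟩
    fromℕ R (length W)              ≈⟨ genFun-at-root d W (pow R ω j) (pow-root ω d j ωᵈ≈1) divisible ⟩
    genFunSum′ R W (pow R ω j)      ∎

lemma7p16 : ∀ {c ℓ : Level} (n k d : ℕ) → 1 ≤ n → d ∣ n →
    (∀ A → A ∈ G n k d → act d A ≡ A) ×
    ((R : CommutativeRing c ℓ) (ω : CommutativeRing.Carrier R) → IsPrimitiveRoot R d ω →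
      ∀ (j : ℕ) → CommutativeRing._≈_ R (fromℕ R (numFixed d j (G n k d))) (genFunSum′ R (G n k d) (pow R ω j)))
lemma7p16 n k zero     1≤n 0∣n = ⊥-elim (<⇒≢ 1≤n (sym (0∣⇒≡0 0∣n)))
lemma7p16 n k (suc d′) _   (divides M n≡MD) =
  (λ A A∈G → All.lookup fixed A∈G) ,
  (λ R ω ω-primitive → trivial-csp R D (G n k D) ω (proj₁ ω-primitive) fixed divisible)
  where
  open Blocks d′
  blockConstant : All (λ A → BlockConstant (χ A) M) (G n k D)
  blockConstant = All.map (λ {A} A∈𝒢 → gcd⇒blockConstant M n≡MD A (proj₂ A∈𝒢)) (all-filter (inG? k D) (allSubsets n))
  fixed : All (λ A → act D A ≡ A) (G n k D)
  fixed = All.map (λ {A} → act-trivial M n≡MD A) blockConstant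
  divisible : All (λ A → D ∣ Sum′ A) (G n k D)
  divisible = All.map (λ {A} → Sum′-divisible M n≡MD A) blockConstant
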